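{- Let $A=[a_{ij}]\in\mathbb{R}^{m\times n}$ be a wide matrix with full rank. Suppose there is an integer $k$ with $0\le k\le n-1$ such that every entry of $A$ on the $r$-th diagonal is nonzero for $1-m\le r\le k$, and every entry of $A$ on the $r$-th diagonal is zero for $k<r\le n-1$. Then $A$ has the SIPP.
   Context: A real $m\times n$ matrix is wide if $m\le n$ and has full rank if its rank is $m$. For an integer $r$ with $1-m\le r\le n-1$, the $r$-th diagonal of an $m\times n$ matrix $A=[a_{ij}]$ is the list of entries $a_{ij}$ with $j-i=r$. A wide real $m\times n$ matrix $A$ has the strong inner product property (SIPP) if the only real symmetric $m\times m$ matrix $X$ satisfying $(XA)\circ A=O$ is $X=O$, where $\circ$ is the entrywise product. -}

module Defs where

open import Level using (Level; _⊔_) renaming (suc to lsuc)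
open import Algebra.Bundles using (CommutativeRing)
open import Data.Nat using (ℕ; zero; suc) renaming (_≤_ to _≤ℕ_; _<_ to _<ℕ_; _+_ to _+ℕ_)
open import Data.Fin using (Fin; toℕ) renaming (zero to fzero; suc to fsuc)
open import Data.Product using (Σ; ∃; _×_; _,_)
open import Relation.Nullary using (¬_)
open import Relation.Binary.Structures using (IsTotalOrder)

-- An axiomatisation of the real numbers: a Dedekind-complete ordered field.
-- (All such structures are isomorphic to ℝ; the stdlib has no reals.)
record RealNumbers (c ℓ₁ ℓ₂ : Level) : Set (lsuc (c ⊔ ℓ₁ ⊔ ℓ₂)) where
  field
    commutativeRing : CommutativeRing c ℓ₁
  open CommutativeRing commutativeRing public
  field
    0≉1      : ¬ (0# ≈ 1#)
    inverse  : ∀ x → ¬ (x ≈ 0#) → ∃ λ y → x * y ≈ 1#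
    _≤ᵣ_          : Carrier → Carrier → Set ℓ₂
    isTotalOrder  : IsTotalOrder _≈_ _≤ᵣ_
    +-mono-≤ᵣ     : ∀ {x y} z → x ≤ᵣ y → (x + z) ≤ᵣ (y + z)
    *-nonneg      : ∀ {x y} → 0# ≤ᵣ x → 0# ≤ᵣ y → 0# ≤ᵣ (x * y)
    sup : (P : Carrier → Set (c ⊔ ℓ₁ ⊔ ℓ₂)) →
          (∃ λ x → P x) →
          (∃ λ b → ∀ x → P x → x ≤ᵣ b) →
          ∃ λ s → (∀ x → P x → x ≤ᵣ s) × (∀ b → (∀ x → P x → x ≤ᵣ b) → s ≤ᵣ b)

module Matrices {c ℓ₁ ℓ₂ : Level} (ℝ : RealNumbers c ℓ₁ ℓ₂) where
  open RealNumbers ℝ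

  Matrix : ℕ → ℕ → Set c
  Matrix m n = Fin m → Fin n → Carrier

  ∑ : ∀ {k} → (Fin k → Carrier) → Carrier
  ∑ {zero}  f = 0#
  ∑ {suc k} f = f fzero + ∑ (λ i → f (fsuc i))

  _⊗_ : ∀ {m p n} → Matrix m p → Matrix p n → Matrix m n
  (X ⊗ A) i j = ∑ (λ l → X i l * A l j)

  _∘ₕ_ : ∀ {m n} → Matrix m n → Matrix m n → Matrix m n
  (A ∘ₕ B) i j = A i j * B i j

  IsZeroMatrix : ∀ {m n} → Matrix m n → Set ℓ₁
  IsZeroMatrix A = ∀ i j → A i j ≈ 0#

  Symmetric : ∀ {m} → Matrix m m → Set ℓ₁
  Symmetric X = ∀ i j → X i j ≈ X j i

  Wide : ∀ {m n} → Matrix m n → Set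
  Wide {m} {n} _ = m ≤ℕ n

  FullRank : ∀ {m n} → Matrix m n → Set (c ⊔ ℓ₁)
  FullRank {m} {n} A =
    ∀ (v : Fin m → Carrier) → (∀ j → ∑ (λ i → v i * A i j) ≈ 0#) → ∀ i → v i ≈ 0#

  SIPP : ∀ {m n} → Matrix m n → Set (c ⊔ ℓ₁)
  SIPP {m} A = ∀ (X : Matrix m m) → Symmetric X → IsZeroMatrix ((X ⊗ A) ∘ₕ A) → IsZeroMatrix X

  -- entry (i,j) lies on the r-th diagonal, r = j - i; "r ≤ k" for k : ℕ
  -- is toℕ j ≤ toℕ i + k, and "k < r" is toℕ i + k < toℕ j.
  DiagonalsUpTo : ∀ {m n} → ℕ → Matrix m n → Set ℓ₁
  DiagonalsUpTo k A = ∀ i j → toℕ j ≤ℕ toℕ i +ℕ k → ¬ (A i j ≈ 0#)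

  DiagonalsAbove : ∀ {m n} → ℕ → Matrix m n → Set ℓ₁
  DiagonalsAbove k A = ∀ i j → toℕ i +ℕ k <ℕ toℕ j → A i j ≈ 0#

{-# OPTIONS --safe #-}
-- The rows of X vanish from the bottom up. Suppose the rows below row i are
-- zero, so by symmetry X i l = 0 for l > i. For j ≤ i + k the entry A i j is
-- nonzero, so (XA ∘ A) i j = 0 forces (XA) i j = 0. For j > i + k every term
-- X i l A l j of (XA) i j vanishes: X i l = 0 when l > i, and A l j = 0 when
-- l ≤ i, because then j − l > k. Hence row i of X annihilates A, and full
-- rank makes it zero.
module Submission where

open import Defs
open import Level using (Level)
open import Data.Nat using (ℕ; zero; suc; _<_; _≤?_; _<?_) renaming (_+_ to _+ℕ_)
open import Data.Nat.Properties using (+-monoˡ-≤; ≤-<-trans; ≰⇒>; ≮⇒≥)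
open import Data.Fin using (Fin; toℕ) renaming (zero to fzero; suc to fsuc)
open import Data.Fin.Induction using (>-wellFounded)
open import Data.Product using (_,_)
open import Data.Sum using (_⊎_; inj₁; inj₂)
open import Induction.WellFounded using (module All)
open import Relation.Nullary using (¬_; yes; no)
import Relation.Binary.Reasoning.Setoid as SetoidReasoning

module _ {c ℓ₁ ℓ₂ : Level} (ℝ : RealNumbers c ℓ₁ ℓ₂) where
  open RealNumbers ℝ
  open Matrices ℝ
  open SetoidReasoning setoid

  *-cancelʳ-≉0 : ∀ {a b} → ¬ (b ≈ 0#) → a * b ≈ 0# → a ≈ 0#
  *-cancelʳ-≉0 {a} {b} b≉0 ab≈0 with inverse b b≉0
  ... | b⁻¹ , bb⁻¹≈1 = begin
    a             ≈⟨ sym (*-identityʳ a) ⟩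
    a * 1#        ≈⟨ *-congˡ (sym bb⁻¹≈1) ⟩
    a * (b * b⁻¹) ≈⟨ sym (*-assoc a b b⁻¹) ⟩
    a * b * b⁻¹   ≈⟨ *-congʳ ab≈0 ⟩
    0# * b⁻¹      ≈⟨ zeroˡ b⁻¹ ⟩
    0#            ∎

  *-≈0 : ∀ {a b} → a ≈ 0# ⊎ b ≈ 0# → a * b ≈ 0#
  *-≈0 {a} {b} (inj₁ a≈0) = trans (*-congʳ a≈0) (zeroˡ b)
  *-≈0 {a} {b} (inj₂ b≈0) = trans (*-congˡ b≈0) (zeroʳ a)

  ∑-≈0 : ∀ {k} (f : Fin k → Carrier) → (∀ l → f l ≈ 0#) → ∑ f ≈ 0#
  ∑-≈0 {zero}  f f≈0 = refl
  ∑-≈0 {suc k} f f≈0 =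
    trans (+-cong (f≈0 fzero) (∑-≈0 (λ l → f (fsuc l)) (λ l → f≈0 (fsuc l))))
          (+-identityˡ 0#)

  ⊗-≈0 : ∀ {m p n} (X : Matrix m p) (A : Matrix p n) i j →
         (∀ l → X i l ≈ 0# ⊎ A l j ≈ 0#) → (X ⊗ A) i j ≈ 0#
  ⊗-≈0 X A i j factor≈0 = ∑-≈0 (λ l → X i l * A l j) (λ l → *-≈0 (factor≈0 l))

  band-SIPP : ∀ {m n} {A : Matrix m n} {k : ℕ} →
              FullRank A → DiagonalsUpTo k A → DiagonalsAbove k A → SIPP A
  band-SIPP {A = A} {k} fullRank up above X symX XA∘A≈0 =
    All.wfRec >-wellFounded _ (λ i → ∀ j → X i j ≈ 0#) row≈0
    where
    row≈0 : ∀ i → (∀ {l} → toℕ i < toℕ l → ∀ j → X l j ≈ 0#) → ∀ j → X i j ≈ 0#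
    row≈0 i lowerRows≈0 = fullRank (X i) XA-row≈0
      where
      XA-row≈0 : ∀ j → (X ⊗ A) i j ≈ 0#
      XA-row≈0 j with toℕ j ≤? toℕ i +ℕ k
      ... | yes j≤i+k = *-cancelʳ-≉0 (up i j j≤i+k) (XA∘A≈0 i j)
      ... | no  j≰i+k = ⊗-≈0 X A i j factor≈0
        where
        factor≈0 : ∀ l → X i l ≈ 0# ⊎ A l j ≈ 0#
        factor≈0 l with toℕ i <? toℕ l
        ... | yes i<l = inj₁ (trans (symX i l) (lowerRows≈0 i<l i))
        ... | no  i≮l = inj₂ (above l j (≤-<-trans (+-monoˡ-≤ k (≮⇒≥ i≮l)) (≰⇒> j≰i+k)))

lemma3p10 : ∀ {c ℓ₁ ℓ₂ : Level} (ℝ : RealNumbers c ℓ₁ ℓ₂) → let open Matrices ℝ in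
    ∀ (m n : ℕ) (A : Matrix m n) → Wide A → FullRank A →
    ∀ (k : ℕ) → k < n → DiagonalsUpTo k A → DiagonalsAbove k A → SIPP A
lemma3p10 ℝ m n A _ fullRank k _ up above = band-SIPP ℝ fullRank up above
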